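{- Let $S=\{s_2,s_1\}\subset\mathbb{N}=\{1,2,\ldots\}$ be a subtraction set with exactly two elements, $s_2<s_1$. Then for every heap size $h\in\mathbb{N}_0$, $$o^1_{\mathrm{FvF}}(h)\ge o^1_{\mathrm{AvA}}(h)\quad\text{and}\quad o^2_{\mathrm{FvF}}(h)\ge o^2_{\mathrm{AvA}}(h).$$ That is, when both players break ties in a friendly manner, each player's PSPE utility is never worse than when both players break ties antagonistically.
   Context: Self-interest cumulative subtraction game: for a finite set $S\subset\mathbb{N}$, there is one heap of $h\in\mathbb{N}_0$ tokens. Two players alternately remove $s\in S$ tokens (with $s\le h$) and add $s$ to their own score. The game ends when the player to move cannot move, i.e. when $h<\min S$. Each player maximizes their own final score. In case of indifference, each player follows a fixed deterministic tie-breaking convention: friendly (F), meaning the player maximizes the opponent's score, or antagonistic (A), meaning the player minimizes it. Let $\tau=\{\mathrm{FvF},\mathrm{FvA},\mathrm{AvF},\mathrm{AvA}\}$. The first letter is the convention of the player to move (player 1) and the second letter is that of the other player (player 2). The dual $\mathsf d$ swaps roles: $\mathsf d(\mathrm{FvF})=\mathrm{FvF}$, $\mathsf d(\mathrm{AvA})=\mathrm{AvA}$, $\mathsf d(\mathrm{AvF})=\mathrm{FvA}$, $\mathsf d(\mathrm{FvA})=\mathrm{AvF}$. Outcomes (PSPE utilities) are defined recursively for $X\in\tau$ as follows. - If $h<\min S$, then $o^1_X(h)=o^2_X(h)=0$. - Otherwise, let $S(h)=S\cap\{1,\ldots,h\}$ and $o^1_X(h)=\max_{s\in S(h)}\big(s+o^2_{\mathsf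 d(X)}(h-s)\big)$. Let $S^*(h)$ be the set of $s\in S(h)$ attaining this maximum. Then $o^2_X(h)=o^1_{\mathsf d(X)}(h-s^*)$, where $s^*$ minimizes $o^1_{\mathsf d(X)}(h-s)$ over $s\in S^*(h)$ if $X\in\{\mathrm{AvF},\mathrm{AvA}\}$, and maximizes it otherwise. -}

module Defs where

open import Data.Nat using (ℕ; zero; suc; _+_; _∸_; _≤_; _<_; _≤ᵇ_; _<ᵇ_)
open import Data.Bool using (Bool; true; false; if_then_else_; _∧_)
open import Data.List using (List; []; _∷_; map; filterᵇ)
open import Data.Product using (_×_; _,_; proj₁; proj₂)

-- Tie-breaking convention: F = friendly (maximize opponent's score),
-- A = antagonistic (minimize opponent's score).
data Tie : Set where
  F A : Tie

-- A game type X ∈ τ: (convention of player to move , convention of other player).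
GType : Set
GType = Tie × Tie

FvF FvA AvF AvA : GType
FvF = F , F
FvA = F , A
AvF = A , F
AvA = A , A

dual : GType → GType
dual (a , b) = (b , a)

-- Among candidate pairs (own value , opponent value), pick the one with maximal
-- own value; ties broken by maximizing (F) or minimizing (A) the opponent value.
better : Tie → ℕ × ℕ → ℕ × ℕ → ℕ × ℕ
better t (a , b) (c , d) =
  if a <ᵇ c then (c , d)
  else if c <ᵇ a then (a , b)
  else (case-tie t)
  where
  case-tie : Tie → ℕ × ℕ
  case-tie F = if b <ᵇ d then (a , d) else (a , b)
  case-tie A = if d <ᵇ b then (a , d) else (a , b)

pick : Tie → ℕ × ℕ → List (ℕ × ℕ) → ℕ × ℕ
pick t best [] = best
pick t best (p ∷ ps) = pick t (better t best p) ps

moves : List ℕ → ℕ → List ℕ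
moves S h = filterᵇ (λ s → (1 ≤ᵇ s) ∧ (s ≤ᵇ h)) S

-- outcome pair (o¹_X(h) , o²_X(h)), computed with fuel (structural recursion);
-- fuel suc h suffices since every move removes at least one token.
outcomeF : ℕ → List ℕ → GType → ℕ → ℕ × ℕ
outcomeF zero S X h = (0 , 0)
outcomeF (suc fuel) S X h with moves S h
... | [] = (0 , 0)
... | m ∷ ms = pick (proj₁ X) (cand m) (map cand ms)
  where
  swapAdd : ℕ → ℕ × ℕ → ℕ × ℕ
  swapAdd s (a , b) = (s + b , a)
  cand : ℕ → ℕ × ℕ
  cand s = swapAdd s (outcomeF fuel S (dual X) (h ∸ s))

outcome : List ℕ → GType → ℕ → ℕ × ℕ
outcome S X h = outcomeF (suc h) S X h

o¹ : List ℕ → GType → ℕ → ℕ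
o¹ S X h = proj₁ (outcome S X h)

o² : List ℕ → GType → ℕ → ℕ
o² S X h = proj₂ (outcome S X h)

-- Write the moves as a < b = a + d, and let v¹ be the mover's AvA payoff. Under AvA
-- the opponent of the mover always receives v¹ of the heap left by the largest legal
-- move. At heap y + b the antagonistic tie-break favours b because v¹ y ≤ v¹ (y + d),
-- and a strictly better small move forces v¹ (y + d) = v¹ y. It is impossible for
-- y < b; for y = x + b it means that v¹ jumps by more than d between x and x + d.
-- When a ≤ d this contradicts v¹ (x + d) ≤ v¹ x + d. When d ≤ a it forces the
-- residue t of x modulo 2b below a, and then v¹ is flat between y and y + d, squeezed
-- between v¹ (t + 2bk) ≥ v¹ t + kb and, for t < 2b, v¹ (t + 2bk) ≤ (k + 1) b.
-- Under FvF the mover maximises over the same candidates with the opponent's payoffs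
-- bounded below inductively, and whichever move is played the opponent gets at least
-- v¹ y, again by monotonicity.

module Submission where

open import Defs
open import Data.Bool using (Bool; true; false; T; T?; _∧_; if_then_else_)
open import Data.Bool.Properties using (T-∧)
open import Data.Empty using (⊥-elim)
open import Data.List using (List; []; _∷_)
open import Data.List.Properties using (map-cong-local; filter-accept; filter-reject)
open import Data.List.Relation.Unary.All as All using (All; []; _∷_)
open import Data.List.Relation.Unary.All.Properties using (all-filter)
open import Data.Nat
  using (ℕ; zero; suc; _+_; _*_; _∸_; _⊔_; _≤_; _<_; _>_; _<ᵇ_; _≤ᵇ_; s≤s; z≤n; _<?_; NonZero; >-nonZero)
open import Data.Nat.DivMod using (_%_; _/_; m≡m%n+[m/n]*n; m%n<n)
open import Data.Nat.Induction using (<-rec; <-Rec)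
open import Data.Nat.Properties
open import Algebra.Properties.CommutativeSemigroup +-commutativeSemigroup
  using (xy∙z≈xz∙y; xy∙z≈x∙zy; xy∙z≈y∙xz; x∙yz≈xz∙y; x∙yz≈y∙xz; x∙yz≈yx∙z)
open import Data.Nat.Tactic.RingSolver using (solve-∀)
open import Data.Product as Product using (_×_; _,_; proj₁; proj₂)
open import Data.Product.Relation.Binary.Pointwise.NonDependent using (Pointwise)
open import Data.Sum using (_⊎_; inj₁; inj₂)
open import Function using (_∘_; Equivalence)
open import Relation.Binary.PropositionalEquality
open import Relation.Nullary using (yes; no)
open import Relation.Nullary.Reflects using (ofʸ; ofⁿ)

open ≤-Reasoning

<ᵇ-true : ∀ {m n} → m < n → (m <ᵇ n) ≡ true
<ᵇ-true {m} {n} m<n with m <ᵇ n | <ᵇ-reflects-< m n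
... | true  | _        = refl
... | false | ofⁿ m≮n = ⊥-elim (m≮n m<n)

<ᵇ-false : ∀ {m n} → n ≤ m → (m <ᵇ n) ≡ false
<ᵇ-false {m} {n} n≤m with m <ᵇ n | <ᵇ-reflects-< m n
... | false | _        = refl
... | true  | ofʸ m<n = ⊥-elim (<⇒≱ m<n n≤m)

m≤o⇒m+n∸o≤n : ∀ {m o} n → m ≤ o → m + n ∸ o ≤ n
m≤o⇒m+n∸o≤n {m} {o} n m≤o = begin
  m + n ∸ o ≤⟨ ∸-monoˡ-≤ o (+-monoˡ-≤ n m≤o) ⟩
  o + n ∸ o ≡⟨ m+n∸m≡n o n ⟩
  n         ∎

better-∈ : ∀ t (p q : ℕ × ℕ) → better t p q ≡ p ⊎ better t p q ≡ q
better-∈ F (x , u) (y , v) with x <ᵇ y | <ᵇ-reflects-< x y | y <ᵇ x | <ᵇ-reflects-< y x | u <ᵇ v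
... | true  | _       | _     | _       | _     = inj₂ refl
... | false | _       | true  | _       | _     = inj₁ refl
... | false | ofⁿ x≮y | false | ofⁿ y≮x | true  = inj₂ (cong (_, v) (≤-antisym (≮⇒≥ y≮x) (≮⇒≥ x≮y)))
... | false | _       | false | _       | false = inj₁ refl
better-∈ A (x , u) (y , v) with x <ᵇ y | <ᵇ-reflects-< x y | y <ᵇ x | <ᵇ-reflects-< y x | v <ᵇ u
... | true  | _       | _     | _       | _     = inj₂ refl
... | false | _       | true  | _       | _     = inj₁ refl
... | false | ofⁿ x≮y | false | ofⁿ y≮x | true  = inj₂ (cong (_, v) (≤-antisym (≮⇒≥ y≮x) (≮⇒≥ x≮y)))
... | false | _       | false | _       | false = inj₁ refl

proj₁-better : ∀ t (p q : ℕ × ℕ) → proj₁ (better t p q) ≡ proj₁ p ⊔ proj₁ q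
proj₁-better t (x , u) (y , v)
  with x <ᵇ y | <ᵇ-reflects-< x y | y <ᵇ x | <ᵇ-reflects-< y x | better-∈ t (x , u) (y , v)
... | true  | ofʸ x<y | _     | _        | _       = sym (m≤n⇒m⊔n≡n (<⇒≤ x<y))
... | false | ofⁿ x≮y | true  | _        | _       = sym (m≥n⇒m⊔n≡m (≮⇒≥ x≮y))
... | false | ofⁿ x≮y | false | _        | inj₁ eq = trans (cong proj₁ eq) (sym (m≥n⇒m⊔n≡m (≮⇒≥ x≮y)))
... | false | _       | false | ofⁿ y≮x | inj₂ eq = trans (cong proj₁ eq) (sym (m≤n⇒m⊔n≡n (≮⇒≥ y≮x)))

≤-proj₂-better : ∀ t {c} (p q : ℕ × ℕ) → c ≤ proj₂ p → c ≤ proj₂ q → c ≤ proj₂ (better t p q)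
≤-proj₂-better t p q c≤p c≤q with better t p q | better-∈ t p q
... | _ | inj₁ refl = c≤p
... | _ | inj₂ refl = c≤q

proj₂-better-A : ∀ (p q : ℕ × ℕ) → proj₂ q ≤ proj₂ p → (proj₁ q < proj₁ p → proj₂ p ≤ proj₂ q) →
                 proj₂ (better A p q) ≡ proj₂ q
proj₂-better-A (x , u) (y , v) v≤u y<x⇒u≤v
  with x <ᵇ y | y <ᵇ x | <ᵇ-reflects-< y x | v <ᵇ u | <ᵇ-reflects-< v u
... | true  | _     | _        | _     | _        = refl
... | false | true  | ofʸ y<x  | _     | _        = ≤-antisym (y<x⇒u≤v y<x) v≤u
... | false | false | _        | true  | _        = refl
... | false | false | _        | false | ofⁿ v≮u = ≤-antisym (≮⇒≥ v≮u) v≤u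

legalᵇ : ℕ → ℕ → Bool
legalᵇ h s = (1 ≤ᵇ s) ∧ (s ≤ᵇ h)

Legal : ℕ → ℕ → Set
Legal h s = 1 ≤ s × s ≤ h

legalᵇ⇒Legal : ∀ {h s} → T (legalᵇ h s) → Legal h s
legalᵇ⇒Legal t = Product.map (≤ᵇ⇒≤ 1 _) (≤ᵇ⇒≤ _ _) (Equivalence.to T-∧ t)

Legal⇒legalᵇ : ∀ {h s} → Legal h s → T (legalᵇ h s)
Legal⇒legalᵇ (1≤s , s≤h) = Equivalence.from T-∧ (≤⇒≤ᵇ 1≤s , ≤⇒≤ᵇ s≤h)

moves-legal : ∀ S h → All (Legal h) (moves S h)
moves-legal S h = All.map legalᵇ⇒Legal (all-filter (T? ∘ legalᵇ h) S)

moves-∷-legal : ∀ {h s} S → Legal h s → moves (s ∷ S) h ≡ s ∷ moves S h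
moves-∷-legal {h} {s} S legal = filter-accept (T? ∘ legalᵇ h) {s} {S} (Legal⇒legalᵇ legal)

moves-∷-illegal : ∀ {h s} S → h < s → moves (s ∷ S) h ≡ moves S h
moves-∷-illegal {h} {s} S h<s =
  filter-reject (T? ∘ legalᵇ h) {s} {S} (λ t → <⇒≱ h<s (proj₂ (legalᵇ⇒Legal t)))

-- The local swapAdd of outcomeF, to which the candidates of outcomeF reduce.
credit : ℕ → ℕ × ℕ → ℕ × ℕ
credit s o = (s + proj₂ o , proj₁ o)

credit-mono : ∀ s {p q} → Pointwise _≤_ _≤_ p q → Pointwise _≤_ _≤_ (credit s p) (credit s q)
credit-mono s (p₁≤q₁ , p₂≤q₂) = +-monoʳ-≤ s p₂≤q₂ , p₁≤q₁

outcomeF-fuel : ∀ S X {f g} h → h < f → h < g → outcomeF f S X h ≡ outcomeF g S X h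
outcomeF-fuel S X {suc f} {suc g} h (s≤s h≤f) (s≤s h≤g) with moves S h | moves-legal S h
... | []     | _                  = refl
... | m ∷ ms | legal-m ∷ legal-ms =
  cong₂ (pick (proj₁ X)) (same legal-m) (map-cong-local {f = candidate f} {g = candidate g} (All.map same legal-ms))
  where
  candidate : ℕ → ℕ → ℕ × ℕ
  candidate fuel s = credit s (outcomeF fuel S (dual X) (h ∸ s))
  same : ∀ {s} → Legal h s → candidate f s ≡ candidate g s
  same {s} (1≤s , s≤h) =
    cong (credit _) (outcomeF-fuel S (dual X) _ (<-≤-trans h∸s<h h≤f) (<-≤-trans h∸s<h h≤g))
    where
    h∸s<h : h ∸ s < h
    h∸s<h = ∸-monoʳ-< 1≤s s≤h

outcomeF-after : ∀ S X {h s z} → h ∸ s ≡ z → z < h → outcomeF h S X (h ∸ s) ≡ outcome S X z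
outcomeF-after S X {h} h∸s≡z z<h = trans (cong (outcomeF h S X) h∸s≡z) (outcomeF-fuel S X _ z<h ≤-refl)

module TwoMoves (a d : ℕ) (a>0 : a > 0) (d>0 : d > 0) where

  b : ℕ
  b = a + d

  a<b : a < b
  a<b = m<m+n a d>0

  d<b : d < b
  d<b = m<n+m d a>0

  b>0 : b > 0
  b>0 = <-trans a>0 a<b

  instance
    2b-nonZero : NonZero (b + b)
    2b-nonZero = >-nonZero (<-≤-trans b>0 (m≤m+n b b))

  +a<b : ∀ {y} → y < d → y + a < b
  +a<b {y} y<d = subst (y + a <_) (+-comm d a) (+-monoˡ-< a y<d)

  +b∸a : ∀ y → y + b ∸ a ≡ y + d
  +b∸a y = trans (+-∸-assoc y (m≤m+n a d)) (cong (y +_) (m+n∸m≡n a d))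

  data Region (x : ℕ) : Set where
    lo  : x < a → Region x
    mid : ∀ y → y < d → x ≡ y + a → Region x
    hi  : ∀ y → x ≡ y + b → Region x

  region : ∀ x → Region x
  region x with x <? a | x <? b
  ... | yes x<a | _       = lo x<a
  ... | no x≮a  | yes x<b =
    mid (x ∸ a) (subst (x ∸ a <_) (m+n∸m≡n a d) (∸-monoˡ-< x<b (≮⇒≥ x≮a))) (sym (m∸n+n≡m (≮⇒≥ x≮a)))
  ... | no _    | no x≮b  = hi (x ∸ b) (sym (m∸n+n≡m (≮⇒≥ x≮b)))

  afterGreedy : ℕ → ℕ
  afterGreedy x = if x <ᵇ a then x else if x <ᵇ b then x ∸ a else x ∸ b

  afterGreedy-lo : ∀ {x} → x < a → afterGreedy x ≡ x
  afterGreedy-lo x<a rewrite <ᵇ-true x<a = refl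

  afterGreedy-mid : ∀ {y} → y < d → afterGreedy (y + a) ≡ y
  afterGreedy-mid {y} y<d rewrite <ᵇ-false (m≤n+m a y) | <ᵇ-true (+a<b y<d) = m+n∸n≡m y a

  afterGreedy-hi : ∀ y → afterGreedy (y + b) ≡ y
  afterGreedy-hi y rewrite <ᵇ-false (≤-trans (<⇒≤ a<b) (m≤n+m b y)) | <ᵇ-false (m≤n+m b y) = m+n∸n≡m y b

  afterGreedy-≤ : ∀ x → afterGreedy x ≤ x
  afterGreedy-≤ x with region x
  ... | lo x<a        = ≤-reflexive (afterGreedy-lo x<a)
  ... | mid y y<d refl = subst (_≤ y + a) (sym (afterGreedy-mid y<d)) (m≤m+n y a)
  ... | hi y refl      = subst (_≤ y + b) (sym (afterGreedy-hi y)) (m≤m+n y b)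

  afterGreedy-< : ∀ {z x n} → z < x → x ≤ n → afterGreedy z < n
  afterGreedy-< {z} z<x x≤n = ≤-<-trans (afterGreedy-≤ z) (<-≤-trans z<x x≤n)

  -- v¹ and v² turn out to be the AvA payoffs (outcome-AvA); the recursion is that of
  -- outcomeF with the opponent's payoff read off the heap left by the largest move.
  v¹F : ℕ → ℕ → ℕ
  v¹F zero    x = 0
  v¹F (suc f) x =
    if x <ᵇ a then 0
    else if x <ᵇ b then a + v¹F f (afterGreedy (x ∸ a))
    else (a + v¹F f (afterGreedy (x ∸ a))) ⊔ (b + v¹F f (afterGreedy (x ∸ b)))

  v¹ v² : ℕ → ℕ
  v¹ x = v¹F (suc x) x
  v² y = v¹ (afterGreedy y)

  v¹F-lo : ∀ f {x} → x < a → v¹F (suc f) x ≡ 0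
  v¹F-lo f x<a rewrite <ᵇ-true x<a = refl

  v¹F-mid : ∀ f {y} → y < d → v¹F (suc f) (y + a) ≡ a + v¹F f (afterGreedy y)
  v¹F-mid f {y} y<d rewrite <ᵇ-false (m≤n+m a y) | <ᵇ-true (+a<b y<d) | m+n∸n≡m y a = refl

  v¹F-hi : ∀ f y → v¹F (suc f) (y + b) ≡ (a + v¹F f (afterGreedy (y + d))) ⊔ (b + v¹F f (afterGreedy y))
  v¹F-hi f y
    rewrite <ᵇ-false (≤-trans (<⇒≤ a<b) (m≤n+m b y)) | <ᵇ-false (m≤n+m b y) | +b∸a y | m+n∸n≡m y b = refl

  v¹F-fuel : ∀ {f g} x → x < f → x < g → v¹F f x ≡ v¹F g x
  v¹F-fuel {suc f} {suc g} x (s≤s x≤f) (s≤s x≤g) with region x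
  ... | lo x<a = trans (v¹F-lo f x<a) (sym (v¹F-lo g x<a))
  ... | mid y y<d refl = begin-equality
    v¹F (suc f) (y + a)       ≡⟨ v¹F-mid f y<d ⟩
    a + v¹F f (afterGreedy y) ≡⟨ cong (a +_) (v¹F-fuel _ (afterGreedy-< y<x x≤f) (afterGreedy-< y<x x≤g)) ⟩
    a + v¹F g (afterGreedy y) ≡⟨ v¹F-mid g y<d ⟨
    v¹F (suc g) (y + a)       ∎
    where
    y<x : y < y + a
    y<x = m<m+n y a>0
  ... | hi y refl = begin-equality
    v¹F (suc f) (y + b)
      ≡⟨ v¹F-hi f y ⟩
    (a + v¹F f (afterGreedy (y + d))) ⊔ (b + v¹F f (afterGreedy y))
      ≡⟨ cong₂ (λ u v → (a + u) ⊔ (b + v))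
               (v¹F-fuel _ (afterGreedy-< y+d<x x≤f) (afterGreedy-< y+d<x x≤g))
               (v¹F-fuel _ (afterGreedy-< y<x x≤f) (afterGreedy-< y<x x≤g)) ⟩
    (a + v¹F g (afterGreedy (y + d))) ⊔ (b + v¹F g (afterGreedy y))
      ≡⟨ v¹F-hi g y ⟨
    v¹F (suc g) (y + b) ∎
    where
    y<x : y < y + b
    y<x = m<m+n y b>0
    y+d<x : y + d < y + b
    y+d<x = +-monoʳ-< y d<b

  v¹-lo : ∀ {x} → x < a → v¹ x ≡ 0
  v¹-lo {x} = v¹F-lo x

  v¹-mid : ∀ {y} → y < d → v¹ (y + a) ≡ a + v² y
  v¹-mid {y} y<d = trans (v¹F-mid (y + a) y<d)
    (cong (a +_) (v¹F-fuel _ (afterGreedy-< (m<m+n y a>0) ≤-refl) ≤-refl))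

  v¹-hi : ∀ y → v¹ (y + b) ≡ (a + v² (y + d)) ⊔ (b + v² y)
  v¹-hi y = trans (v¹F-hi (y + b) y) (cong₂ (λ u v → (a + u) ⊔ (b + v))
    (v¹F-fuel _ (afterGreedy-< (+-monoʳ-< y d<b) ≤-refl) ≤-refl)
    (v¹F-fuel _ (afterGreedy-< (m<m+n y b>0) ≤-refl) ≤-refl))

  v²-lo : ∀ {y} → y < a → v² y ≡ 0
  v²-lo y<a = trans (cong v¹ (afterGreedy-lo y<a)) (v¹-lo y<a)

  v²-mid : ∀ {y} → y < d → v² (y + a) ≡ v¹ y
  v²-mid y<d = cong v¹ (afterGreedy-mid y<d)

  v²-hi : ∀ y → v² (y + b) ≡ v¹ y
  v²-hi y = cong v¹ (afterGreedy-hi y)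

  v²-mid-+d : ∀ {y} → y < d → v² (y + a + d) ≡ v² (y + a)
  v²-mid-+d {y} y<d = begin-equality
    v² (y + a + d) ≡⟨ cong v² (+-assoc y a d) ⟩
    v² (y + b)     ≡⟨ v²-hi y ⟩
    v¹ y           ≡⟨ v²-mid y<d ⟨
    v² (y + a)     ∎

  v²-hi-+d : ∀ y → v² (y + b + d) ≡ v¹ (y + d)
  v²-hi-+d y = trans (cong v² (xy∙z≈xz∙y y b d)) (v²-hi (y + d))

  v¹F≤id : ∀ f x → v¹F f x ≤ x
  v¹F≤id zero    x = z≤n
  v¹F≤id (suc f) x with region x
  ... | lo x<a = ≤-trans (≤-reflexive (v¹F-lo f x<a)) z≤n
  ... | mid y y<d refl = begin
    v¹F (suc f) (y + a)       ≡⟨ v¹F-mid f y<d ⟩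
    a + v¹F f (afterGreedy y) ≤⟨ +-monoʳ-≤ a (≤-trans (v¹F≤id f _) (afterGreedy-≤ y)) ⟩
    a + y                     ≡⟨ +-comm a y ⟩
    y + a                     ∎
  ... | hi y refl = begin
    v¹F (suc f) (y + b)
      ≡⟨ v¹F-hi f y ⟩
    (a + v¹F f (afterGreedy (y + d))) ⊔ (b + v¹F f (afterGreedy y))
      ≤⟨ ⊔-mono-≤ (+-monoʳ-≤ a (≤-trans (v¹F≤id f _) (afterGreedy-≤ (y + d))))
                  (+-monoʳ-≤ b (≤-trans (v¹F≤id f _) (afterGreedy-≤ y))) ⟩
    (a + (y + d)) ⊔ (b + y)
      ≡⟨ cong₂ _⊔_ (x∙yz≈y∙xz a y d) (+-comm b y) ⟩
    (y + b) ⊔ (y + b)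
      ≡⟨ ⊔-idem (y + b) ⟩
    y + b ∎

  v¹[x]≤x : ∀ x → v¹ x ≤ x
  v¹[x]≤x x = v¹F≤id (suc x) x

  v²[y]≤y∸a : ∀ y → v² y ≤ y ∸ a
  v²[y]≤y∸a y with region y
  ... | lo y<a = ≤-trans (≤-reflexive (v²-lo y<a)) z≤n
  ... | mid z z<d refl = begin
    v² (z + a) ≡⟨ v²-mid z<d ⟩
    v¹ z       ≤⟨ v¹[x]≤x z ⟩
    z          ≡⟨ m+n∸n≡m z a ⟨
    z + a ∸ a  ∎
  ... | hi z refl = begin
    v² (z + b) ≡⟨ v²-hi z ⟩
    v¹ z       ≤⟨ v¹[x]≤x z ⟩
    z          ≤⟨ m≤m+n z d ⟩
    z + d      ≡⟨ +b∸a z ⟨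
    z + b ∸ a  ∎

  v²[y+d]≤d : ∀ {y} → y < a → v² (y + d) ≤ d
  v²[y+d]≤d {y} y<a = ≤-trans (v²[y]≤y∸a (y + d)) (m≤o⇒m+n∸o≤n d (<⇒≤ y<a))

  a+v²≤v¹ : ∀ y → a + v² y ≤ v¹ (y + a)
  a+v²≤v¹ y with y <? d
  ... | yes y<d = ≤-reflexive (sym (v¹-mid y<d))
  ... | no y≮d = begin
    a + v² y                      ≡⟨ cong (λ w → a + v² w) z+d≡y ⟨
    a + v² (z + d)                ≤⟨ m≤m⊔n _ _ ⟩
    (a + v² (z + d)) ⊔ (b + v² z) ≡⟨ v¹-hi z ⟨
    v¹ (z + b)                    ≡⟨ cong v¹ (trans (x∙yz≈xz∙y z a d) (cong (_+ a) z+d≡y)) ⟩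
    v¹ (y + a)                    ∎
    where
    z : ℕ
    z = y ∸ d
    z+d≡y : z + d ≡ y
    z+d≡y = m∸n+n≡m (≮⇒≥ y≮d)

  b+v²≤v¹ : ∀ y → b + v² y ≤ v¹ (y + b)
  b+v²≤v¹ y = subst (b + v² y ≤_) (sym (v¹-hi y)) (m≤n⊔m _ _)

  a≤v¹ : ∀ {x} → a ≤ x → a ≤ v¹ x
  a≤v¹ {x} a≤x = begin
    a                  ≤⟨ m≤m+n a _ ⟩
    a + v² (x ∸ a)     ≤⟨ a+v²≤v¹ (x ∸ a) ⟩
    v¹ (x ∸ a + a)     ≡⟨ cong v¹ (m∸n+n≡m a≤x) ⟩
    v¹ x               ∎

  b≤v¹ : ∀ {x} → b ≤ x → b ≤ v¹ x
  b≤v¹ {x} b≤x = begin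
    b                  ≤⟨ m≤m+n b _ ⟩
    b + v² (x ∸ b)     ≤⟨ b+v²≤v¹ (x ∸ b) ⟩
    v¹ (x ∸ b + b)     ≡⟨ cong v¹ (m∸n+n≡m b≤x) ⟩
    v¹ x               ∎

  v²-monoᵈ : ∀ y → <-Rec (λ z → v¹ z ≤ v¹ (z + d)) y → v² y ≤ v² (y + d)
  v²-monoᵈ y rec with region y
  ... | lo y<a = ≤-trans (≤-reflexive (v²-lo y<a)) z≤n
  ... | mid z z<d refl = ≤-reflexive (sym (v²-mid-+d z<d))
  ... | hi z refl = begin
    v² (z + b)     ≡⟨ v²-hi z ⟩
    v¹ z           ≤⟨ rec (m<m+n z b>0) ⟩
    v¹ (z + d)     ≡⟨ v²-hi-+d z ⟨
    v² (z + b + d) ∎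

  v¹-monoᵈ : ∀ x → v¹ x ≤ v¹ (x + d)
  v¹-monoᵈ = <-rec _ step
    where
    step : ∀ x → <-Rec (λ z → v¹ z ≤ v¹ (z + d)) x → v¹ x ≤ v¹ (x + d)
    step x rec with region x
    ... | lo x<a = ≤-trans (≤-reflexive (v¹-lo x<a)) z≤n
    ... | mid y y<d refl = begin
      v¹ (y + a)     ≡⟨ v¹-mid y<d ⟩
      a + v² y       ≤⟨ +-monoˡ-≤ (v² y) (<⇒≤ a<b) ⟩
      b + v² y       ≤⟨ b+v²≤v¹ y ⟩
      v¹ (y + b)     ≡⟨ cong v¹ (+-assoc y a d) ⟨
      v¹ (y + a + d) ∎
    ... | hi y refl = begin
      v¹ (y + b)                    ≡⟨ v¹-hi y ⟩
      (a + v² (y + d)) ⊔ (b + v² y) ≤⟨ ⊔-lub (+-monoˡ-≤ _ (<⇒≤ a<b))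
                                             (+-monoʳ-≤ b (v²-monoᵈ y (λ z<y → rec (<-trans z<y (m<m+n y b>0))))) ⟩
      b + v² (y + d)                ≤⟨ b+v²≤v¹ (y + d) ⟩
      v¹ (y + d + b)                ≡⟨ cong v¹ (xy∙z≈xz∙y y b d) ⟨
      v¹ (y + b + d)                ∎

  v²-lipschitzᵈ : ∀ y → <-Rec (λ z → v¹ (z + d) ≤ v¹ z + d) y → v² (y + d) ≤ v² y + d
  v²-lipschitzᵈ y rec with region y
  ... | lo y<a = ≤-trans (v²[y+d]≤d y<a) (m≤n+m d _)
  ... | mid z z<d refl = ≤-trans (≤-reflexive (v²-mid-+d z<d)) (m≤m+n _ d)
  ... | hi z refl = begin
    v² (z + b + d) ≡⟨ v²-hi-+d z ⟩
    v¹ (z + d)     ≤⟨ rec (m<m+n z b>0) ⟩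
    v¹ z + d       ≡⟨ cong (_+ d) (v²-hi z) ⟨
    v² (z + b) + d ∎

  a+v²≤d : a ≤ d → ∀ {y} → y < d → a + v² y ≤ d
  a+v²≤d a≤d {y} y<d with region y
  ... | lo y<a = subst (_≤ d) (sym (trans (cong (a +_) (v²-lo y<a)) (+-identityʳ a))) a≤d
  ... | mid z z<d refl = begin
    a + v² (z + a) ≡⟨ cong (a +_) (v²-mid z<d) ⟩
    a + v¹ z       ≤⟨ +-monoʳ-≤ a (v¹[x]≤x z) ⟩
    a + z          ≡⟨ +-comm a z ⟩
    z + a          ≤⟨ <⇒≤ y<d ⟩
    d              ∎
  ... | hi z refl = ⊥-elim (<⇒≱ y<d (≤-trans (<⇒≤ d<b) (m≤n+m b z)))

  v¹-lipschitzᵈ : a ≤ d → ∀ x → v¹ (x + d) ≤ v¹ x + d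
  v¹-lipschitzᵈ a≤d = <-rec _ step
    where
    step : ∀ x → <-Rec (λ z → v¹ (z + d) ≤ v¹ z + d) x → v¹ (x + d) ≤ v¹ x + d
    step x rec with region (x + d)
    ... | lo x+d<a = ≤-trans (≤-reflexive (v¹-lo x+d<a)) z≤n
    ... | mid y y<d x+d≡y+a = begin
      v¹ (x + d) ≡⟨ cong v¹ x+d≡y+a ⟩
      v¹ (y + a) ≡⟨ v¹-mid y<d ⟩
      a + v² y   ≤⟨ a+v²≤d a≤d y<d ⟩
      d          ≤⟨ m≤n+m d _ ⟩
      v¹ x + d   ∎
    ... | hi y x+d≡y+b = begin
      v¹ (x + d)                    ≡⟨ cong v¹ x+d≡y+b ⟩
      v¹ (y + b)                    ≡⟨ v¹-hi y ⟩
      (a + v² (y + d)) ⊔ (b + v² y) ≤⟨ ⊔-lub (+-monoʳ-≤ a (v²-lipschitzᵈ y (λ z<y → rec (<-≤-trans z<y y≤x))))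
                                             (≤-reflexive (xy∙z≈x∙zy a d (v² y))) ⟩
      a + (v² y + d)                ≡⟨ +-assoc a (v² y) d ⟨
      a + v² y + d                  ≤⟨ +-monoˡ-≤ d (a+v²≤v¹ y) ⟩
      v¹ (y + a) + d                ≡⟨ cong (λ w → v¹ w + d) x≡y+a ⟨
      v¹ x + d                      ∎
      where
      x≡y+a : x ≡ y + a
      x≡y+a = +-cancelʳ-≡ d x (y + a) (trans x+d≡y+b (sym (+-assoc y a d)))
      y≤x : y ≤ x
      y≤x = subst (y ≤_) (sym x≡y+a) (m≤m+n y a)

  v¹-2b-step : ∀ t k → v¹ (t + suc k * (b + b)) ≡ (a + v¹ (t + d + k * (b + b))) ⊔ (b + v¹ (t + k * (b + b)))
  v¹-2b-step t k = begin-equality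
    v¹ (t + suc k * (b + b))                ≡⟨ cong v¹ (x∙yz≈xz∙y t (b + b) (k * (b + b))) ⟩
    v¹ (y + (b + b))                        ≡⟨ cong v¹ (+-assoc y b b) ⟨
    v¹ (y + b + b)                          ≡⟨ v¹-hi (y + b) ⟩
    (a + v² (y + b + d)) ⊔ (b + v² (y + b)) ≡⟨ cong₂ (λ u v → (a + u) ⊔ (b + v)) (v²-hi-+d y) (v²-hi y) ⟩
    (a + v¹ (y + d)) ⊔ (b + v¹ y)           ≡⟨ cong (λ u → (a + v¹ u) ⊔ (b + v¹ y)) (xy∙z≈xz∙y t _ d) ⟩
    (a + v¹ (t + d + k * (b + b))) ⊔ (b + v¹ y) ∎
    where
    y : ℕ
    y = t + k * (b + b)

  v¹-2b-lower : ∀ k t → v¹ t + k * b ≤ v¹ (t + k * (b + b))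
  v¹-2b-lower zero    t = ≤-reflexive (trans (+-identityʳ (v¹ t)) (cong v¹ (sym (+-identityʳ t))))
  v¹-2b-lower (suc k) t = begin
    v¹ t + (b + k * b)          ≡⟨ x∙yz≈y∙xz (v¹ t) b (k * b) ⟩
    b + (v¹ t + k * b)          ≤⟨ +-monoʳ-≤ b (v¹-2b-lower k t) ⟩
    b + v¹ (t + k * (b + b))    ≤⟨ m≤n⊔m (a + v¹ (t + d + k * (b + b))) _ ⟩
    (a + v¹ (t + d + k * (b + b))) ⊔ (b + v¹ (t + k * (b + b))) ≡⟨ v¹-2b-step t k ⟨
    v¹ (t + suc k * (b + b))    ∎

  v¹-2b-upper : ∀ k t → v¹ (t + k * (b + b)) ≤ t + k * b
  v¹-2b-upper zero    t = v¹[x]≤x (t + 0)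
  v¹-2b-upper (suc k) t = begin
    v¹ (t + suc k * (b + b))
      ≡⟨ v¹-2b-step t k ⟩
    (a + v¹ (t + d + k * (b + b))) ⊔ (b + v¹ (t + k * (b + b)))
      ≤⟨ ⊔-mono-≤ (+-monoʳ-≤ a (v¹-2b-upper k (t + d))) (+-monoʳ-≤ b (v¹-2b-upper k t)) ⟩
    (a + (t + d + k * b)) ⊔ (b + (t + k * b))
      ≡⟨ cong₂ _⊔_ (+-shuffle a d t (k * b)) (x∙yz≈y∙xz b t (k * b)) ⟩
    (t + (b + k * b)) ⊔ (t + (b + k * b))
      ≡⟨ ⊔-idem _ ⟩
    t + suc k * b ∎
    where
    +-shuffle : ∀ x y z m → x + (z + y + m) ≡ z + ((x + y) + m)
    +-shuffle = solve-∀

  v²[y]≤y∸b : d ≤ a → ∀ y → v² y ≤ y ∸ b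
  v²[y]≤y∸b d≤a y with region y
  ... | lo y<a = ≤-trans (≤-reflexive (v²-lo y<a)) z≤n
  ... | mid z z<d refl = ≤-trans (≤-reflexive (trans (v²-mid z<d) (v¹-lo (<-≤-trans z<d d≤a)))) z≤n
  ... | hi z refl = begin
    v² (z + b) ≡⟨ v²-hi z ⟩
    v¹ z       ≤⟨ v¹[x]≤x z ⟩
    z          ≡⟨ m+n∸n≡m z b ⟨
    z + b ∸ b  ∎

  v¹-below-2b : d ≤ a → ∀ {t} → t < b + b → v¹ t ≤ b
  v¹-below-2b d≤a {t} t<2b with region t
  ... | lo t<a = ≤-trans (v¹[x]≤x t) (<⇒≤ (<-trans t<a a<b))
  ... | mid y y<d refl = ≤-trans (v¹[x]≤x (y + a)) (<⇒≤ (+a<b y<d))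
  ... | hi y refl = begin
    v¹ (y + b)                    ≡⟨ v¹-hi y ⟩
    (a + v² (y + d)) ⊔ (b + v² y) ≤⟨ ⊔-lub (+-monoʳ-≤ a v²[y+d]≤d′)
                                           (≤-trans (+-monoʳ-≤ b v²[y]≤0) (≤-reflexive (+-identityʳ b))) ⟩
    b                             ∎
    where
    y≤b : y ≤ b
    y≤b = <⇒≤ (+-cancelʳ-< b y b t<2b)
    v²[y+d]≤d′ : v² (y + d) ≤ d
    v²[y+d]≤d′ = ≤-trans (v²[y]≤y∸b d≤a (y + d)) (m≤o⇒m+n∸o≤n d y≤b)
    v²[y]≤0 : v² y ≤ 0
    v²[y]≤0 = ≤-trans (v²[y]≤y∸b d≤a y) (≤-reflexive (m≤n⇒m∸n≡0 y≤b))

  v¹-2b-upper-d≤a : d ≤ a → ∀ k t → v¹ (t + k * (b + b)) ≤ suc k * b + (t ∸ (b + b))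
  v¹-2b-upper-residue : d ≤ a → ∀ k {t} → t < b + b → v¹ (t + k * (b + b)) ≤ suc k * b

  v¹-2b-upper-d≤a d≤a k t with t <? b + b
  ... | yes t<2b = begin
    v¹ (t + k * (b + b))      ≤⟨ v¹-2b-upper-residue d≤a k t<2b ⟩
    suc k * b                 ≡⟨ +-identityʳ _ ⟨
    suc k * b + 0             ≡⟨ cong (suc k * b +_) (m≤n⇒m∸n≡0 (<⇒≤ t<2b)) ⟨
    suc k * b + (t ∸ (b + b)) ∎
  ... | no t≮2b = begin
    v¹ (t + k * (b + b))     ≡⟨ cong v¹ t+k*2b≡r+[1+k]*2b ⟩
    v¹ (r + suc k * (b + b)) ≤⟨ v¹-2b-upper (suc k) r ⟩
    r + suc k * b            ≡⟨ +-comm r _ ⟩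
    suc k * b + r            ∎
    where
    r : ℕ
    r = t ∸ (b + b)
    t+k*2b≡r+[1+k]*2b : t + k * (b + b) ≡ r + suc k * (b + b)
    t+k*2b≡r+[1+k]*2b = trans (cong (_+ k * (b + b)) (sym (m∸n+n≡m (≮⇒≥ t≮2b)))) (+-assoc r (b + b) _)

  v¹-2b-upper-residue d≤a zero {t} t<2b =
    subst₂ _≤_ (cong v¹ (sym (+-identityʳ t))) (sym (+-identityʳ b)) (v¹-below-2b d≤a t<2b)
  v¹-2b-upper-residue d≤a (suc k) {t} t<2b = begin
    v¹ (t + suc k * (b + b))
      ≡⟨ v¹-2b-step t k ⟩
    (a + v¹ (t + d + k * (b + b))) ⊔ (b + v¹ (t + k * (b + b)))
      ≤⟨ ⊔-lub small-move (+-monoʳ-≤ b (v¹-2b-upper-residue d≤a k t<2b)) ⟩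
    b + suc k * b ∎
    where
    small-move : a + v¹ (t + d + k * (b + b)) ≤ b + suc k * b
    small-move = begin
      a + v¹ (t + d + k * (b + b))        ≤⟨ +-monoʳ-≤ a (v¹-2b-upper-d≤a d≤a k (t + d)) ⟩
      a + (suc k * b + (t + d ∸ (b + b))) ≡⟨ x∙yz≈xz∙y a _ _ ⟩
      a + (t + d ∸ (b + b)) + suc k * b   ≤⟨ +-monoˡ-≤ _ (+-monoʳ-≤ a (m≤o⇒m+n∸o≤n d (<⇒≤ t<2b))) ⟩
      b + suc k * b                       ∎

  b+[t+d∸2b]≤v¹+d : ∀ {t} → a ≤ t → t < b + b → b + (t + d ∸ (b + b)) ≤ v¹ t + d
  b+[t+d∸2b]≤v¹+d {t} a≤t t<2b with t <? b
  ... | yes t<b = begin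
    b + (t + d ∸ (b + b)) ≡⟨ cong (b +_) (m≤n⇒m∸n≡0 (+-mono-≤ (<⇒≤ t<b) (<⇒≤ d<b))) ⟩
    b + 0                 ≡⟨ +-identityʳ b ⟩
    a + d                 ≤⟨ +-monoˡ-≤ d (a≤v¹ a≤t) ⟩
    v¹ t + d              ∎
  ... | no t≮b = begin
    b + (t + d ∸ (b + b)) ≤⟨ +-monoʳ-≤ b (m≤o⇒m+n∸o≤n d (<⇒≤ t<2b)) ⟩
    b + d                 ≤⟨ +-monoˡ-≤ d (b≤v¹ (≮⇒≥ t≮b)) ⟩
    v¹ t + d              ∎

  v¹-lipschitzᵈ-residue≥a : d ≤ a → ∀ k {t} → a ≤ t → t < b + b →
                    v¹ (t + k * (b + b) + d) ≤ v¹ (t + k * (b + b)) + d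
  v¹-lipschitzᵈ-residue≥a d≤a k {t} a≤t t<2b = begin
    v¹ (t + k * (b + b) + d)        ≡⟨ cong v¹ (xy∙z≈xz∙y t _ d) ⟩
    v¹ (t + d + k * (b + b))        ≤⟨ v¹-2b-upper-d≤a d≤a k (t + d) ⟩
    suc k * b + (t + d ∸ (b + b))   ≡⟨ xy∙z≈y∙xz b (k * b) _ ⟩
    k * b + (b + (t + d ∸ (b + b))) ≤⟨ +-monoʳ-≤ (k * b) (b+[t+d∸2b]≤v¹+d a≤t t<2b) ⟩
    k * b + (v¹ t + d)              ≡⟨ x∙yz≈yx∙z (k * b) (v¹ t) d ⟩
    v¹ t + k * b + d                ≤⟨ +-monoˡ-≤ d (v¹-2b-lower k t) ⟩
    v¹ (t + k * (b + b)) + d        ∎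

  v¹-flatᵈ-residue<a : d ≤ a → ∀ k {t} → t < a → v¹ (t + k * (b + b) + b + d) ≤ v¹ (t + k * (b + b) + b)
  v¹-flatᵈ-residue<a d≤a k {t} t<a = begin
    v¹ (t + k * (b + b) + b + d)      ≡⟨ cong (λ x → v¹ (x + d)) (xy∙z≈xz∙y t _ b) ⟩
    v¹ (t + b + k * (b + b) + d)      ≡⟨ cong v¹ (xy∙z≈xz∙y (t + b) _ d) ⟩
    v¹ (t + b + d + k * (b + b))      ≤⟨ v¹-2b-upper-d≤a d≤a k (t + b + d) ⟩
    suc k * b + (t + b + d ∸ (b + b)) ≡⟨ cong (suc k * b +_) (m≤n⇒m∸n≡0 t+b+d≤2b) ⟩
    suc k * b + 0                     ≡⟨ +-identityʳ _ ⟩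
    b + k * b                         ≤⟨ +-monoˡ-≤ (k * b) (b≤v¹ (m≤n+m b t)) ⟩
    v¹ (t + b) + k * b                ≤⟨ v¹-2b-lower k (t + b) ⟩
    v¹ (t + b + k * (b + b))          ≡⟨ cong v¹ (xy∙z≈xz∙y t b _) ⟩
    v¹ (t + k * (b + b) + b)          ∎
    where
    t+b+d≤2b : t + b + d ≤ b + b
    t+b+d≤2b = begin
      t + b + d ≤⟨ +-monoˡ-≤ d (+-monoˡ-≤ b (<⇒≤ t<a)) ⟩
      a + b + d ≡⟨ cong (_+ d) (+-comm a b) ⟩
      b + a + d ≡⟨ +-assoc b a d ⟩
      b + b     ∎

  v¹-jumpᵈ⇒flatᵈ : d ≤ a → ∀ w → v¹ w + d < v¹ (w + d) → v¹ (w + b + d) ≤ v¹ (w + b)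
  v¹-jumpᵈ⇒flatᵈ d≤a w jump with w % (b + b) <? a
  ... | yes t<a = subst (λ x → v¹ (x + b + d) ≤ v¹ (x + b)) (sym (m≡m%n+[m/n]*n w (b + b)))
                        (v¹-flatᵈ-residue<a d≤a (w / (b + b)) t<a)
  ... | no t≮a = ⊥-elim (<⇒≱ jump (subst (λ x → v¹ (x + d) ≤ v¹ x + d) (sym (m≡m%n+[m/n]*n w (b + b)))
                        (v¹-lipschitzᵈ-residue≥a d≤a (w / (b + b)) (≮⇒≥ t≮a) (m%n<n w (b + b)))))

  b+v²<a+v²⇒v¹-flat : ∀ y → b + v² y < a + v² (y + d) → v¹ (y + d) ≤ v¹ y
  b+v²<a+v²⇒v¹-flat y a-better with region y
  ... | lo y<a = ⊥-elim (<⇒≱ a-better (begin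
    a + v² (y + d) ≤⟨ +-monoʳ-≤ a (v²[y+d]≤d y<a) ⟩
    b              ≤⟨ m≤m+n b _ ⟩
    b + v² y       ∎))
  ... | mid z z<d refl = ⊥-elim (<⇒≱ a-better (begin
    a + v² (z + a + d) ≡⟨ cong (a +_) (v²-mid-+d z<d) ⟩
    a + v² (z + a)     ≤⟨ +-monoˡ-≤ _ (<⇒≤ a<b) ⟩
    b + v² (z + a)     ∎))
  ... | hi z refl = flat (≤-total d a)
    where
    jump : v¹ z + d < v¹ (z + d)
    jump = +-cancelˡ-< a _ _ (begin-strict
      a + (v¹ z + d)     ≡⟨ xy∙z≈x∙zy a d (v¹ z) ⟨
      b + v¹ z           ≡⟨ cong (b +_) (v²-hi z) ⟨
      b + v² (z + b)     <⟨ a-better ⟩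
      a + v² (z + b + d) ≡⟨ cong (a +_) (v²-hi-+d z) ⟩
      a + v¹ (z + d)     ∎)
    flat : d ≤ a ⊎ a ≤ d → v¹ (z + b + d) ≤ v¹ (z + b)
    flat (inj₁ d≤a) = v¹-jumpᵈ⇒flatᵈ d≤a z jump
    flat (inj₂ a≤d) = ⊥-elim (<⇒≱ jump (v¹-lipschitzᵈ a≤d z))

  S : List ℕ
  S = a ∷ b ∷ []

  moves-lo : ∀ {h} → h < a → moves S h ≡ []
  moves-lo h<a = trans (moves-∷-illegal (b ∷ []) h<a) (moves-∷-illegal [] (<-trans h<a a<b))

  moves-mid : ∀ {h} → a ≤ h → h < b → moves S h ≡ a ∷ []
  moves-mid a≤h h<b = trans (moves-∷-legal (b ∷ []) (a>0 , a≤h)) (cong (a ∷_) (moves-∷-illegal [] h<b))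

  moves-hi : ∀ {h} → b ≤ h → moves S h ≡ a ∷ b ∷ []
  moves-hi b≤h = trans (moves-∷-legal (b ∷ []) (a>0 , ≤-trans (<⇒≤ a<b) b≤h))
                       (cong (a ∷_) (moves-∷-legal [] (b>0 , b≤h)))

  outcome-lo : ∀ X {h} → h < a → outcome S X h ≡ (0 , 0)
  outcome-lo X h<a rewrite moves-lo h<a = refl

  outcome-mid : ∀ X {y} → y < d → outcome S X (y + a) ≡ credit a (outcome S (dual X) y)
  outcome-mid X {y} y<d rewrite moves-mid (m≤n+m a y) (+a<b y<d) =
    cong (credit a) (outcomeF-after S (dual X) {s = a} (m+n∸n≡m y a) (m<m+n y a>0))

  outcome-hi : ∀ X y → outcome S X (y + b) ≡
               better (proj₁ X) (credit a (outcome S (dual X) (y + d))) (credit b (outcome S (dual X) y))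
  outcome-hi X y rewrite moves-hi (m≤n+m b y) = cong₂ (λ p q → better (proj₁ X) (credit a p) (credit b q))
    (outcomeF-after S (dual X) {s = a} (+b∸a y) (+-monoʳ-< y d<b))
    (outcomeF-after S (dual X) {s = b} (m+n∸n≡m y b) (m<m+n y b>0))

  outcome-AvA : ∀ h → outcome S AvA h ≡ (v¹ h , v² h)
  outcome-AvA = <-rec _ step
    where
    step : ∀ h → <-Rec (λ h → outcome S AvA h ≡ (v¹ h , v² h)) h → outcome S AvA h ≡ (v¹ h , v² h)
    step h rec with region h
    ... | lo h<a = trans (outcome-lo AvA h<a) (sym (cong₂ _,_ (v¹-lo h<a) (v²-lo h<a)))
    ... | mid y y<d refl rewrite outcome-mid AvA y<d | rec (m<m+n y a>0) =
      sym (cong₂ _,_ (v¹-mid y<d) (v²-mid y<d))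
    ... | hi y refl rewrite outcome-hi AvA y | rec (+-monoʳ-< y d<b) | rec (m<m+n y b>0) =
      cong₂ _,_ (trans (proj₁-better A (a + v² (y + d) , v¹ (y + d)) (b + v² y , v¹ y)) (sym (v¹-hi y)))
                (trans (proj₂-better-A _ _ (v¹-monoᵈ y) (b+v²<a+v²⇒v¹-flat y)) (sym (v²-hi y)))

  outcome-FvF-≥ : ∀ h → Pointwise _≤_ _≤_ (v¹ h , v² h) (outcome S FvF h)
  outcome-FvF-≥ = <-rec _ step
    where
    step : ∀ h → <-Rec (λ h → Pointwise _≤_ _≤_ (v¹ h , v² h) (outcome S FvF h)) h →
           Pointwise _≤_ _≤_ (v¹ h , v² h) (outcome S FvF h)
    step h rec with region h
    ... | lo h<a = ≤-trans (≤-reflexive (v¹-lo h<a)) z≤n , ≤-trans (≤-reflexive (v²-lo h<a)) z≤n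
    ... | mid y y<d refl rewrite outcome-mid FvF y<d | v¹-mid y<d | v²-mid y<d = credit-mono a (rec (m<m+n y a>0))
    ... | hi y refl rewrite outcome-hi FvF y | v¹-hi y | v²-hi y =
      subst ((a + v² (y + d)) ⊔ (b + v² y) ≤_) (sym (proj₁-better F P Q)) (⊔-mono-≤ (proj₁ P≥) (proj₁ Q≥)) ,
      ≤-proj₂-better F P Q (≤-trans (v¹-monoᵈ y) (proj₂ P≥)) (proj₂ Q≥)
      where
      P Q : ℕ × ℕ
      P = credit a (outcome S FvF (y + d))
      Q = credit b (outcome S FvF y)
      P≥ : Pointwise _≤_ _≤_ (a + v² (y + d) , v¹ (y + d)) P
      P≥ = credit-mono a (rec (+-monoʳ-< y d<b))
      Q≥ : Pointwise _≤_ _≤_ (b + v² y , v¹ y) Q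
      Q≥ = credit-mono b (rec (m<m+n y b>0))

  AvA≤FvF : ∀ h → Pointwise _≤_ _≤_ (outcome S AvA h) (outcome S FvF h)
  AvA≤FvF h rewrite outcome-AvA h = outcome-FvF-≥ h

theorem1 : (s₂ s₁ : ℕ) → 1 ≤ s₂ → s₂ < s₁ → (h : ℕ) →
    (o¹ (s₂ ∷ s₁ ∷ []) AvA h ≤ o¹ (s₂ ∷ s₁ ∷ []) FvF h)
    × (o² (s₂ ∷ s₁ ∷ []) AvA h ≤ o² (s₂ ∷ s₁ ∷ []) FvF h)
theorem1 s₂ s₁ s₂>0 s₂<s₁ h =
  subst (λ s → Pointwise _≤_ _≤_ (outcome (s₂ ∷ s ∷ []) AvA h) (outcome (s₂ ∷ s ∷ []) FvF h))
        (m+[n∸m]≡n (<⇒≤ s₂<s₁))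
        (TwoMoves.AvA≤FvF s₂ (s₁ ∸ s₂) s₂>0 (m<n⇒0<n∸m s₂<s₁) h)
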